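{- Let $n,k,t$ be positive integers with $n>k>t$, suppose a Generalized Euler Square of index $n,k,t$ exists, and let $\Phi(n,k,t)$ be the $nk\times n^{t+1}$ binary matrix whose columns are the vectors attached to its $n^{t+1}$ $k$-tuples. Then $\Phi_0=\frac{1}{\sqrt{k}}\Phi(n,k,t)$ satisfies the restricted isometry property of order $k'$ with constant $\delta_{k'}=\frac{t(k'-1)}{k}$ for every positive integer $k'<\frac{k}{t}+1$.
   Context: A Generalized Euler Square (GES) of index $n,k,t$, with $n>k>t\ge1$, is a family of $n^{t+1}$ $k$-tuples $a(\mathbf i)=(a_{\mathbf i,1},\dots,a_{\mathbf i,k})$ indexed by $\mathbf i\in\{1,\dots,n\}^{t+1}$, with entries in $\{0,\dots,n-1\}$, such that: (1) if $\mathbf i,\mathbf j$ differ in exactly one position then $a_{\mathbf i,r}\neq a_{\mathbf j,r}$ for all $r$; (2) if $\mathbf i,\mathbf j$ differ in at least two positions then the tuples agree in at most $t$ coordinates. To a $k$-tuple $(t_1,\dots,t_k)$ with entries in $\{0,\dots,n-1\}$ one attaches $v\in\{0,1\}^{nk}$ with $v(i)=1$ iff $i=(l-1)n+t_l+1$ for some $1\le l\le k$. An $m\times M$ matrix $A$ satisfies the restricted isometry property of order $s$ with constant $\delta_s\in(0,1)$ if $(1-\delta_s)\|x\|_2^2\le\|Ax\|_2^2\le(1+\delta_s)\|x\|_2^2$ for all $x\in\mathbb R^M$ with at most $s$ nonzero entries.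
   Formalization: The sparse vectors x in the restricted isometry property have rational entries instead of real ones. -}

module Defs where

open import Data.Nat as ℕ using (ℕ; zero; suc; _∸_; NonZero)
open import Data.Fin using (Fin; combine)
open import Data.Fin.Properties using (any?)
open import Data.Fin.Properties as FinP using ()
open import Data.Vec using (Vec; []; _∷_; lookup)
open import Data.List using (List; []; _∷_; [_]; map; concatMap; filter; length; foldr; allFin)
open import Data.Integer using (+_)
open import Data.Rational using (ℚ; 0ℚ; 1ℚ; _+_; _*_; _-_; _≤_; _/_)
open import Data.Rational.Properties using () renaming (_≟_ to _≟ℚ_)
open import Relation.Nullary using (¬_; does; ¬?)
open import Relation.Binary.PropositionalEquality using (_≡_)
open import Data.Bool using (if_then_else_)
open import Data.Product using (_×_)

-- Multi-indices i ∈ {1..n}^(t+1) are represented as Vec (Fin n) (suc t)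
-- (0-based entries); a k-tuple with entries in {0..n-1} is Vec (Fin n) k.

allVecs : (n m : ℕ) → List (Vec (Fin n) m)
allVecs n zero = [ [] ]
allVecs n (suc m) = concatMap (λ a → map (a ∷_) (allVecs n m)) (allFin n)

hamming : {n m : ℕ} → Vec (Fin n) m → Vec (Fin n) m → ℕ
hamming {n} {m} u v =
  length (filter (λ p → ¬? (lookup u p FinP.≟ lookup v p)) (allFin m))

agreements : {n k : ℕ} → Vec (Fin n) k → Vec (Fin n) k → ℕ
agreements {n} {k} u v =
  length (filter (λ r → lookup u r FinP.≟ lookup v r) (allFin k))

record IsGES (n k t : ℕ) (a : Vec (Fin n) (suc t) → Vec (Fin n) k) : Set where
  field
    cond1 : ∀ i j → hamming i j ≡ 1 → ∀ (r : Fin k) → ¬ (lookup (a i) r ≡ lookup (a j) r)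
    cond2 : ∀ i j → 2 ℕ.≤ hamming i j → agreements (a i) (a j) ℕ.≤ t

-- The binary matrix Φ(n,k,t): rows indexed by Fin (k * n), row index
-- combine l s has value (0-based) l*n + s; column a(i) has a 1 in row
-- (l-1)n + t_l + 1 (1-based) for every l, i.e. in row combine l (t_l) (0-based).
Φ : {n k t : ℕ} → (Vec (Fin n) (suc t) → Vec (Fin n) k) →
    Fin (k ℕ.* n) → Vec (Fin n) (suc t) → ℚ
Φ {n} {k} a row col =
  if does (any? (λ l → row FinP.≟ combine l (lookup (a col) l))) then 1ℚ else 0ℚ

sumℚ : List ℚ → ℚ
sumℚ = foldr _+_ 0ℚ

sqNorm : {n t : ℕ} → (Vec (Fin n) (suc t) → ℚ) → ℚ
sqNorm {n} {t} x = sumℚ (map (λ c → x c * x c) (allVecs n (suc t)))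

support : {n t : ℕ} → (Vec (Fin n) (suc t) → ℚ) → ℕ
support {n} {t} x = length (filter (λ c → ¬? (x c ≟ℚ 0ℚ)) (allVecs n (suc t)))

mulVec : {m n t : ℕ} → (Fin m → Vec (Fin n) (suc t) → ℚ) →
         (Vec (Fin n) (suc t) → ℚ) → Fin m → ℚ
mulVec {m} {n} {t} A x r = sumℚ (map (λ c → A r c * x c) (allVecs n (suc t)))

sqNormRows : {m : ℕ} → (Fin m → ℚ) → ℚ
sqNormRows {m} y = sumℚ (map (λ r → y r * y r) (allFin m))

RIP : {n t : ℕ} → ((Vec (Fin n) (suc t) → ℚ) → ℚ) → ℕ → ℚ → Set
RIP {n} {t} normA² s δ =
  ∀ (x : Vec (Fin n) (suc t) → ℚ) → support x ℕ.≤ s →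
    ((1ℚ - δ) * sqNorm x ≤ normA² x) × (normA² x ≤ (1ℚ + δ) * sqNorm x)

-- ‖Φ₀ x‖² where Φ₀ = (1/√k) Φ, i.e. ‖Φ₀ x‖² = (1/k) ‖Φ x‖²
Φ₀sqNorm : {n k t : ℕ} → .{{_ : NonZero k}} → (Vec (Fin n) (suc t) → Vec (Fin n) k) →
           (Vec (Fin n) (suc t) → ℚ) → ℚ
Φ₀sqNorm {n} {k} {t} a x = (+ 1 / k) * sqNormRows (mulVec (Φ a) x)

-- Column c of Φ has a single one in each of its k blocks of n rows, so the
-- Gram matrix ΦᵀΦ has diagonal k and off-diagonal entries ⟨Φ_c, Φ_d⟩ equal to
-- the number of coordinates in which a(c) and a(d) agree.  The GES axioms bound
-- these by t: index vectors at Hamming distance 1 give no agreement at all,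
-- those at distance at least 2 at most t.  For x supported on s columns,
-- ‖Φx‖² − k‖x‖² = Σ_{c≠d} x_c x_d ⟨Φ_c, Φ_d⟩, and 2|x_c x_d| ≤ x_c² + x_d²
-- bounds its absolute value by t Σ_{c≠d in the support} x_c² = t(s − 1)‖x‖².
-- Dividing by k gives δ = t(s − 1)/k.

module Submission where

open import Defs

-- A separate scope: the development uses the rational _≤_ and _*_, the
-- statement of mainTheorem4 the natural ones.
module RestrictedIsometry where

  open import Level using (Level)
  open import Data.Bool using (true; false; if_then_else_)
  open import Data.Nat as ℕ using (ℕ; zero; suc; z≤n; s≤s)
  open import Data.Integer as ℤ using (+_)
  import Data.Integer.Properties as ℤ
  open import Data.Integer.Solver using () renaming (module +-*-Solver to ℤ-Solver)
  open import Data.Fin as Fin using (Fin; zero; suc; _↑ˡ_; _↑ʳ_; combine)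
  import Data.Fin.Properties as Fin
  open import Data.Vec as Vec using (Vec; []; _∷_; lookup)
  import Data.Vec.Properties as Vec
  open import Data.Vec.Relation.Binary.Pointwise.Extensional using (ext; Pointwise-≡⇒≡)
  open import Data.List using (List; []; _∷_; _++_; map; concatMap; filter; length; tabulate; allFin)
  import Data.List.Properties as List
  import Data.List.Relation.Unary.All.Properties as All
  import Data.List.Relation.Unary.Any.Properties as Any
  open import Data.Rational using (ℚ; 0ℚ; 1ℚ; _+_; _*_; _-_; -_; _≤_; _/_; toℚᵘ; nonNegative; nonPositive)
  open import Data.Rational.Properties
  open import Data.Rational.Solver using () renaming (module +-*-Solver to ℚ-Solver)
  open import Data.Rational.Unnormalised as ℚᵘ using (mkℚᵘ; *≡*) renaming (_≃_ to _≃ᵘ_)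
  import Data.Rational.Unnormalised.Properties as ℚᵘ
  open import Data.Product using (_×_; _,_; proj₁; proj₂)
  open import Data.Sum using (inj₁; inj₂)
  open import Function using (_∘_; id)
  open import Relation.Binary.Definitions using (DecidableEquality)
  open import Relation.Binary.PropositionalEquality
  open import Relation.Nullary using (Dec; yes; no; does; ¬_; ¬?; _×-dec_; contradiction)
  open import Relation.Nullary.Decidable using (does-⇔)
  open import Relation.Unary using (Pred; Decidable)
  open import Function.Bundles using (mk⇔)

  private variable
    ℓ : Level
    A : Set ℓ

  fromℕ : ℕ → ℚ
  fromℕ m = + m / 1

  -- Identities between fractions are proved on unnormalised representatives,
  -- where they become integer identities.
  private
    toℚᵘ-/ : ∀ i j → toℚᵘ (i / suc j) ≃ᵘ mkℚᵘ i j
    toℚᵘ-/ i j = toℚᵘ-fromℚᵘ (mkℚᵘ i j)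

  fromℕ-suc : ∀ m → fromℕ (suc m) ≡ 1ℚ + fromℕ m
  fromℕ-suc m = toℚᵘ-injective (begin
    toℚᵘ (fromℕ (suc m))          ≈⟨ toℚᵘ-/ (+ suc m) 0 ⟩
    mkℚᵘ (+ suc m) 0              ≈⟨ *≡* cross ⟩
    ℚᵘ.1ℚᵘ ℚᵘ.+ mkℚᵘ (+ m) 0      ≈⟨ ℚᵘ.+-congʳ ℚᵘ.1ℚᵘ (toℚᵘ-/ (+ m) 0) ⟨
    toℚᵘ 1ℚ ℚᵘ.+ toℚᵘ (fromℕ m)   ≈⟨ toℚᵘ-homo-+ 1ℚ (fromℕ m) ⟨
    toℚᵘ (1ℚ + fromℕ m)           ∎)
    where
    open ℚᵘ.≃-Reasoning
    open ℤ-Solver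
    cross : + suc m ℤ.* (+ 1 ℤ.* + 1) ≡ (+ 1 ℤ.* + 1 ℤ.+ + m ℤ.* + 1) ℤ.* + 1
    cross = trans (cong (ℤ._* (+ 1 ℤ.* + 1)) (ℤ.pos-+ 1 m))
      (solve 1 (λ i → (con (+ 1) :+ i) :* (con (+ 1) :* con (+ 1))
                    := (con (+ 1) :* con (+ 1) :+ i :* con (+ 1)) :* con (+ 1)) refl (+ m))

  fromℕ-* : ∀ m n → fromℕ (m ℕ.* n) ≡ fromℕ m * fromℕ n
  fromℕ-* m n = toℚᵘ-injective (begin
    toℚᵘ (fromℕ (m ℕ.* n))               ≈⟨ toℚᵘ-/ (+ (m ℕ.* n)) 0 ⟩
    mkℚᵘ (+ (m ℕ.* n)) 0                 ≈⟨ *≡* (cong (ℤ._* + 1) (ℤ.pos-* m n)) ⟩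
    mkℚᵘ (+ m) 0 ℚᵘ.* mkℚᵘ (+ n) 0       ≈⟨ ℚᵘ.*-cong (toℚᵘ-/ (+ m) 0) (toℚᵘ-/ (+ n) 0) ⟨
    toℚᵘ (fromℕ m) ℚᵘ.* toℚᵘ (fromℕ n)   ≈⟨ toℚᵘ-homo-* (fromℕ m) (fromℕ n) ⟨
    toℚᵘ (fromℕ m * fromℕ n)             ∎)
    where open ℚᵘ.≃-Reasoning

  m/n≡1/n*m : ∀ m j → + m / suc j ≡ (+ 1 / suc j) * fromℕ m
  m/n≡1/n*m m j = toℚᵘ-injective (begin
    toℚᵘ (+ m / suc j)                         ≈⟨ toℚᵘ-/ (+ m) j ⟩
    mkℚᵘ (+ m) j                               ≈⟨ *≡* cross ⟩
    mkℚᵘ (+ 1) j ℚᵘ.* mkℚᵘ (+ m) 0             ≈⟨ ℚᵘ.*-cong (toℚᵘ-/ (+ 1) j) (toℚᵘ-/ (+ m) 0) ⟨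
    toℚᵘ (+ 1 / suc j) ℚᵘ.* toℚᵘ (fromℕ m)     ≈⟨ toℚᵘ-homo-* (+ 1 / suc j) (fromℕ m) ⟨
    toℚᵘ ((+ 1 / suc j) * fromℕ m)             ∎)
    where
    open ℚᵘ.≃-Reasoning
    open ℤ-Solver
    cross : + m ℤ.* (+ suc j ℤ.* + 1) ≡ (+ 1 ℤ.* + m) ℤ.* + suc j
    cross = solve 2 (λ i d → i :* (d :* con (+ 1)) := (con (+ 1) :* i) :* d) refl (+ m) (+ suc j)

  1/n*n≡1 : ∀ j → (+ 1 / suc j) * fromℕ (suc j) ≡ 1ℚ
  1/n*n≡1 j = begin
    (+ 1 / suc j) * fromℕ (suc j)   ≡⟨ m/n≡1/n*m (suc j) j ⟨
    + suc j / suc j                 ≡⟨ toℚᵘ-injective (ℚᵘ.≃-trans (toℚᵘ-/ (+ suc j) j) (*≡* (ℤ.*-comm (+ suc j) (+ 1)))) ⟩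
    1ℚ                              ∎
    where open ≡-Reasoning

  fromℕ-nonNeg : ∀ m → 0ℚ ≤ fromℕ m
  fromℕ-nonNeg m = nonNegative⁻¹ (fromℕ m) {{normalize-nonNeg m 1}}

  fromℕ-mono-≤ : ∀ {m n} → m ℕ.≤ n → fromℕ m ≤ fromℕ n
  fromℕ-mono-≤ {n = n} z≤n = fromℕ-nonNeg n
  fromℕ-mono-≤ {suc m} {suc n} (s≤s m≤n) =
    subst₂ _≤_ (sym (fromℕ-suc m)) (sym (fromℕ-suc n)) (+-monoʳ-≤ 1ℚ (fromℕ-mono-≤ m≤n))

  𝟙 : {P : Set ℓ} → Dec P → ℚ
  𝟙 P? = if does P? then 1ℚ else 0ℚ

  module _ {P : Set ℓ} (P? : Dec P) where

    𝟙+𝟙-¬≡1 : 𝟙 P? + 𝟙 (¬? P?) ≡ 1ℚ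
    𝟙+𝟙-¬≡1 with does P?
    ... | true = refl
    ... | false = refl

    𝟙-⇔ : {Q : Set ℓ} (Q? : Dec Q) → (P → Q) → (Q → P) → 𝟙 P? ≡ 𝟙 Q?
    𝟙-⇔ Q? to from = cong (if_then 1ℚ else 0ℚ) (does-⇔ (mk⇔ to from) P? Q?)

    𝟙-×-dec : {Q : Set ℓ} (Q? : Dec Q) → 𝟙 (P? ×-dec Q?) ≡ 𝟙 P? * 𝟙 Q?
    𝟙-×-dec Q? with does P?
    ... | true = sym (*-identityˡ (𝟙 Q?))
    ... | false = sym (*-zeroˡ (𝟙 Q?))

  ∑ : List A → (A → ℚ) → ℚ
  ∑ xs f = sumℚ (map f xs)

  infixr 6.5 ∑
  syntax ∑ xs (λ x → e) = ∑[ x ← xs ] e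

  module _ {A : Set ℓ} where

    ∑-cong : ∀ (xs : List A) {f g : A → ℚ} → (∀ x → f x ≡ g x) → ∑ xs f ≡ ∑ xs g
    ∑-cong []       f≗g = refl
    ∑-cong (x ∷ xs) f≗g = cong₂ _+_ (f≗g x) (∑-cong xs f≗g)

    ∑-zero : ∀ (xs : List A) → ∑[ x ← xs ] 0ℚ ≡ 0ℚ
    ∑-zero []       = refl
    ∑-zero (x ∷ xs) = trans (+-identityˡ _) (∑-zero xs)

    ∑-distrib-+ : ∀ (xs : List A) f g → ∑[ x ← xs ] (f x + g x) ≡ ∑ xs f + ∑ xs g
    ∑-distrib-+ []       f g = refl
    ∑-distrib-+ (x ∷ xs) f g = begin
      (f x + g x) + ∑[ y ← xs ] (f y + g y)   ≡⟨ cong (_+_ (f x + g x)) (∑-distrib-+ xs f g) ⟩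
      (f x + g x) + (∑ xs f + ∑ xs g)         ≡⟨ +-assoc-middle (f x) (g x) (∑ xs f) (∑ xs g) ⟩
      (f x + ∑ xs f) + (g x + ∑ xs g)         ∎
      where
      open ≡-Reasoning
      +-assoc-middle : ∀ a b c d → (a + b) + (c + d) ≡ (a + c) + (b + d)
      +-assoc-middle = solve 4 (λ a b c d → (a :+ b) :+ (c :+ d) := (a :+ c) :+ (b :+ d)) refl
        where open ℚ-Solver

    *-distribˡ-∑ : ∀ (xs : List A) c f → c * ∑ xs f ≡ ∑[ x ← xs ] c * f x
    *-distribˡ-∑ []       c f = *-zeroʳ c
    *-distribˡ-∑ (x ∷ xs) c f = trans (*-distribˡ-+ c (f x) (∑ xs f)) (cong (_+_ (c * f x)) (*-distribˡ-∑ xs c f))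

    *-distribʳ-∑ : ∀ (xs : List A) c f → ∑ xs f * c ≡ ∑[ x ← xs ] f x * c
    *-distribʳ-∑ xs c f = trans (*-comm (∑ xs f) c) (trans (*-distribˡ-∑ xs c f) (∑-cong xs (λ x → *-comm c (f x))))

    ∑-count : ∀ {p} {P : Pred A p} (P? : Decidable P) xs → ∑[ x ← xs ] 𝟙 (P? x) ≡ fromℕ (length (filter P? xs))
    ∑-count P? []       = refl
    ∑-count P? (x ∷ xs) with does (P? x)
    ... | true  = trans (cong (_+_ 1ℚ) (∑-count P? xs)) (sym (fromℕ-suc (length (filter P? xs))))
    ... | false = trans (+-identityˡ _) (∑-count P? xs)

    ∑-++ : ∀ (xs ys : List A) f → ∑ (xs ++ ys) f ≡ ∑ xs f + ∑ ys f
    ∑-++ []       ys f = sym (+-identityˡ _)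
    ∑-++ (x ∷ xs) ys f = trans (cong (_+_ (f x)) (∑-++ xs ys f)) (sym (+-assoc (f x) _ _))

  module _ {A : Set ℓ} {B : Set ℓ} where

    ∑-map : ∀ (h : A → B) xs f → ∑ (map h xs) f ≡ ∑[ x ← xs ] f (h x)
    ∑-map h []       f = refl
    ∑-map h (x ∷ xs) f = cong (_+_ (f (h x))) (∑-map h xs f)

    ∑-concatMap : ∀ (h : A → List B) xs f → ∑ (concatMap h xs) f ≡ ∑[ x ← xs ] ∑ (h x) f
    ∑-concatMap h []       f = refl
    ∑-concatMap h (x ∷ xs) f = trans (∑-++ (h x) (concatMap h xs) f) (cong (_+_ (∑ (h x) f)) (∑-concatMap h xs f))

    ∑-comm : ∀ (xs : List A) (ys : List B) (f : A → B → ℚ) → ∑[ x ← xs ] ∑[ y ← ys ] f x y ≡ ∑[ y ← ys ] ∑[ x ← xs ] f x y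
    ∑-comm []       ys f = sym (∑-zero ys)
    ∑-comm (x ∷ xs) ys f = trans (cong (_+_ (∑ ys (f x))) (∑-comm xs ys f))
                                 (sym (∑-distrib-+ ys (f x) (λ y → ∑[ x′ ← xs ] f x′ y)))

    ∑*∑≡∑∑ : ∀ (xs : List A) (ys : List B) f g → ∑ xs f * ∑ ys g ≡ ∑[ x ← xs ] ∑[ y ← ys ] f x * g y
    ∑*∑≡∑∑ xs ys f g = trans (*-distribʳ-∑ xs (∑ ys g) f) (∑-cong xs (λ x → *-distribˡ-∑ ys (f x) g))

  ∑-allFin-suc : ∀ n (f : Fin (suc n) → ℚ) → ∑ (allFin (suc n)) f ≡ f zero + ∑[ i ← allFin n ] f (suc i)
  ∑-allFin-suc n f = cong (_+_ (f zero)) (begin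
    ∑ (tabulate suc) f              ≡⟨ cong (λ is → ∑ is f) (List.map-tabulate id suc) ⟨
    ∑ (map suc (allFin n)) f        ≡⟨ ∑-map suc (allFin n) f ⟩
    ∑[ i ← allFin n ] f (suc i)     ∎)
    where open ≡-Reasoning

  ∑-allFin-+ : ∀ m n (f : Fin (m ℕ.+ n) → ℚ) →
               ∑ (allFin (m ℕ.+ n)) f ≡ ∑[ i ← allFin m ] f (i ↑ˡ n) + ∑[ j ← allFin n ] f (m ↑ʳ j)
  ∑-allFin-+ zero    n f = sym (+-identityˡ _)
  ∑-allFin-+ (suc m) n f = begin
    ∑ (allFin (suc m ℕ.+ n)) f
      ≡⟨ ∑-allFin-suc (m ℕ.+ n) f ⟩
    f zero + ∑[ i ← allFin (m ℕ.+ n) ] f (suc i)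
      ≡⟨ cong (_+_ (f zero)) (∑-allFin-+ m n (f ∘ suc)) ⟩
    f zero + ((∑[ i ← allFin m ] f (suc (i ↑ˡ n))) + ∑[ j ← allFin n ] f (suc (m ↑ʳ j)))
      ≡⟨ +-assoc (f zero) _ _ ⟨
    (f zero + ∑[ i ← allFin m ] f (suc (i ↑ˡ n))) + ∑[ j ← allFin n ] f (suc m ↑ʳ j)
      ≡⟨ cong (_+ (∑[ j ← allFin n ] f (suc m ↑ʳ j))) (∑-allFin-suc m (λ i → f (i ↑ˡ n))) ⟨
    ∑[ i ← allFin (suc m) ] f (i ↑ˡ n) + ∑[ j ← allFin n ] f (suc m ↑ʳ j)
      ∎
    where open ≡-Reasoning

  ∑-allFin-combine : ∀ m n (f : Fin (m ℕ.* n) → ℚ) →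
                     ∑ (allFin (m ℕ.* n)) f ≡ ∑[ i ← allFin m ] ∑[ j ← allFin n ] f (combine i j)
  ∑-allFin-combine zero    n f = refl
  ∑-allFin-combine (suc m) n f = begin
    ∑ (allFin (n ℕ.+ m ℕ.* n)) f
      ≡⟨ ∑-allFin-+ n (m ℕ.* n) f ⟩
    ∑[ j ← allFin n ] f (j ↑ˡ m ℕ.* n) + ∑[ r ← allFin (m ℕ.* n) ] f (n ↑ʳ r)
      ≡⟨ cong (_+_ (∑[ j ← allFin n ] f (j ↑ˡ m ℕ.* n))) (∑-allFin-combine m n (λ r → f (n ↑ʳ r))) ⟩
    ∑[ j ← allFin n ] f (combine {suc m} zero j) + ∑[ i ← allFin m ] ∑[ j ← allFin n ] f (combine (suc i) j)
      ≡⟨ ∑-allFin-suc m (λ i → ∑[ j ← allFin n ] f (combine i j)) ⟨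
    ∑[ i ← allFin (suc m) ] ∑[ j ← allFin n ] f (combine i j)
      ∎
    where open ≡-Reasoning

  -- Holds exactly when xs lists every element of A once.
  Sifting : {A : Set ℓ} → DecidableEquality A → List A → Set ℓ
  Sifting {A = A} _≟_ xs = ∀ c (f : A → ℚ) → ∑[ d ← xs ] 𝟙 (c ≟ d) * f d ≡ f c

  allFin-sifting : ∀ n → Sifting Fin._≟_ (allFin n)
  allFin-sifting (suc n) zero f = begin
    ∑[ d ← allFin (suc n) ] 𝟙 (zero Fin.≟ d) * f d    ≡⟨ ∑-allFin-suc n (λ d → 𝟙 (zero Fin.≟ d) * f d) ⟩
    1ℚ * f zero + ∑[ i ← allFin n ] 0ℚ * f (suc i)     ≡⟨ cong₂ _+_ (*-identityˡ (f zero)) off-diagonal ⟩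
    f zero + 0ℚ                                        ≡⟨ +-identityʳ (f zero) ⟩
    f zero                                             ∎
    where
    open ≡-Reasoning
    off-diagonal : ∑[ i ← allFin n ] 0ℚ * f (suc i) ≡ 0ℚ
    off-diagonal = trans (∑-cong (allFin n) (λ i → *-zeroˡ (f (suc i)))) (∑-zero (allFin n))
  allFin-sifting (suc n) (suc c) f = begin
    ∑[ d ← allFin (suc n) ] 𝟙 (suc c Fin.≟ d) * f d              ≡⟨ ∑-allFin-suc n (λ d → 𝟙 (suc c Fin.≟ d) * f d) ⟩
    0ℚ * f zero + ∑[ i ← allFin n ] 𝟙 (c Fin.≟ i) * f (suc i)     ≡⟨ cong (_+ rest) (*-zeroˡ (f zero)) ⟩
    0ℚ + ∑[ i ← allFin n ] 𝟙 (c Fin.≟ i) * f (suc i)              ≡⟨ +-identityˡ rest ⟩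
    ∑[ i ← allFin n ] 𝟙 (c Fin.≟ i) * f (suc i)                   ≡⟨ allFin-sifting n c (f ∘ suc) ⟩
    f (suc c)                                                     ∎
    where
    open ≡-Reasoning
    rest = ∑[ i ← allFin n ] 𝟙 (c Fin.≟ i) * f (suc i)

  _≟ⱽ_ : ∀ {n m} → DecidableEquality (Vec (Fin n) m)
  _≟ⱽ_ = Vec.≡-dec Fin._≟_

  allVecs-sifting : ∀ n m → Sifting _≟ⱽ_ (allVecs n m)
  allVecs-sifting n zero    [] f = trans (+-identityʳ (1ℚ * f [])) (*-identityˡ (f []))
  allVecs-sifting n (suc m) (a ∷ w) f = begin
    ∑[ d ← allVecs n (suc m) ] 𝟙 ((a ∷ w) ≟ⱽ d) * f d
      ≡⟨ ∑-concatMap (λ b → map (b ∷_) (allVecs n m)) (allFin n) _ ⟩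
    ∑[ b ← allFin n ] ∑ (map (b ∷_) (allVecs n m)) (λ d → 𝟙 ((a ∷ w) ≟ⱽ d) * f d)
      ≡⟨ ∑-cong (allFin n) (λ b → ∑-map (b ∷_) (allVecs n m) _) ⟩
    ∑[ b ← allFin n ] ∑[ v ← allVecs n m ] 𝟙 ((a ∷ w) ≟ⱽ (b ∷ v)) * f (b ∷ v)
      ≡⟨ ∑-cong (allFin n) (λ b → ∑-cong (allVecs n m) (λ v → split-head b v)) ⟩
    ∑[ b ← allFin n ] ∑[ v ← allVecs n m ] 𝟙 (a Fin.≟ b) * (𝟙 (w ≟ⱽ v) * f (b ∷ v))
      ≡⟨ ∑-cong (allFin n) (λ b → *-distribˡ-∑ (allVecs n m) (𝟙 (a Fin.≟ b)) _) ⟨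
    ∑[ b ← allFin n ] 𝟙 (a Fin.≟ b) * (∑[ v ← allVecs n m ] 𝟙 (w ≟ⱽ v) * f (b ∷ v))
      ≡⟨ ∑-cong (allFin n) (λ b → cong (𝟙 (a Fin.≟ b) *_) (allVecs-sifting n m w (λ v → f (b ∷ v)))) ⟩
    ∑[ b ← allFin n ] 𝟙 (a Fin.≟ b) * f (b ∷ w)
      ≡⟨ allFin-sifting n a (λ b → f (b ∷ w)) ⟩
    f (a ∷ w)
      ∎
    where
    open ≡-Reasoning
    split-head : ∀ b v → 𝟙 ((a ∷ w) ≟ⱽ (b ∷ v)) * f (b ∷ v) ≡ 𝟙 (a Fin.≟ b) * (𝟙 (w ≟ⱽ v) * f (b ∷ v))
    split-head b v = trans (cong (_* f (b ∷ v)) (𝟙-×-dec (a Fin.≟ b) (w ≟ⱽ v)))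
                           (*-assoc (𝟙 (a Fin.≟ b)) (𝟙 (w ≟ⱽ v)) (f (b ∷ v)))

  ≤-by-gap : ∀ {p q} d → 0ℚ ≤ d → p + d ≡ q → p ≤ q
  ≤-by-gap {p} d 0≤d refl = subst (_≤ p + d) (+-identityʳ p) (+-monoʳ-≤ p 0≤d)

  p≤q⇒0≤q-p : ∀ {p q} → p ≤ q → 0ℚ ≤ q - p
  p≤q⇒0≤q-p {p} {q} p≤q = subst (_≤ q - p) (+-inverseʳ p) (+-monoˡ-≤ (- p) p≤q)

  0≤p*q : ∀ {p q} → 0ℚ ≤ p → 0ℚ ≤ q → 0ℚ ≤ p * q
  0≤p*q {p} {q} 0≤p 0≤q = nonNegative⁻¹ (p * q) {{nonNeg*nonNeg⇒nonNeg p {{nonNegative 0≤p}} q {{nonNegative 0≤q}}}}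

  0≤p*p : ∀ p → 0ℚ ≤ p * p
  0≤p*p p with ≤-total 0ℚ p
  ... | inj₁ 0≤p = 0≤p*q 0≤p 0≤p
  ... | inj₂ p≤0 = nonNegative⁻¹ (p * p) {{nonPos*nonPos⇒nonPos p {{nonPositive p≤0}} p {{nonPositive p≤0}}}}

  p+p≤q+q⇒p≤q : ∀ {p q} → p + p ≤ q + q → p ≤ q
  p+p≤q+q⇒p≤q {p} {q} p+p≤q+q with p ≤? q
  ... | yes p≤q = p≤q
  ... | no  p≰q = contradiction (<-≤-trans (+-mono-< q<p q<p) p+p≤q+q) (<-irrefl refl)
    where q<p = ≰⇒> p≰q

  +-cancelʳ-≤ : ∀ {p q} r → p + r ≤ q + r → p ≤ q
  +-cancelʳ-≤ {p} {q} r p+r≤q+r = subst₂ _≤_ (cancel p) (cancel q) (+-monoˡ-≤ (- r) p+r≤q+r)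
    where
    cancel : ∀ s → s + r - r ≡ s
    cancel s = solve 2 (λ s r → s :+ r :- r := s) refl s r
      where open ℚ-Solver

  ∑-nonNeg : ∀ (xs : List A) {f : A → ℚ} → (∀ x → 0ℚ ≤ f x) → 0ℚ ≤ ∑ xs f
  ∑-nonNeg []       _     = ≤-refl
  ∑-nonNeg (x ∷ xs) 0≤f = +-mono-≤ (0≤f x) (∑-nonNeg xs 0≤f)

  infix 4 ∣_∣≤_

  ∣_∣≤_ : ℚ → ℚ → Set
  ∣ p ∣≤ r = - r ≤ p × p ≤ r

  ∣∣≤-cong : ∀ {p p′ r r′} → p ≡ p′ → r ≡ r′ → ∣ p ∣≤ r → ∣ p′ ∣≤ r′
  ∣∣≤-cong refl refl p≤r = p≤r

  ∣0∣≤0 : ∣ 0ℚ ∣≤ 0ℚ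
  ∣0∣≤0 = ≤-refl , ≤-refl

  ∣∣≤-+ : ∀ {p q r s} → ∣ p ∣≤ r → ∣ q ∣≤ s → ∣ p + q ∣≤ r + s
  ∣∣≤-+ {r = r} {s} (-r≤p , p≤r) (-s≤q , q≤s) =
    subst (_≤ _) (sym (neg-distrib-+ r s)) (+-mono-≤ -r≤p -s≤q) , +-mono-≤ p≤r q≤s

  ∣∣≤-half : ∀ {p r} → ∣ p + p ∣≤ r + r → ∣ p ∣≤ r
  ∣∣≤-half {r = r} (-r-r≤p+p , p+p≤r+r) =
    p+p≤q+q⇒p≤q (subst (_≤ _) (neg-distrib-+ r r) -r-r≤p+p) , p+p≤q+q⇒p≤q p+p≤r+r

  ∣∣≤-mono : ∀ {p r s} → r ≤ s → ∣ p ∣≤ r → ∣ p ∣≤ s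
  ∣∣≤-mono r≤s (-r≤p , p≤r) = ≤-trans (neg-antimono-≤ r≤s) -r≤p , ≤-trans p≤r r≤s

  ∑-∣∣≤ : ∀ (xs : List A) {f g : A → ℚ} → (∀ x → ∣ f x ∣≤ g x) → ∣ ∑ xs f ∣≤ ∑ xs g
  ∑-∣∣≤ []       _     = ∣0∣≤0
  ∑-∣∣≤ (x ∷ xs) f≤g = ∣∣≤-+ (f≤g x) (∑-∣∣≤ xs f≤g)

  ∣∣≤⇒around : ∀ {p q r} → ∣ p ∣≤ r → q - r ≤ q + p × q + p ≤ q + r
  ∣∣≤⇒around {q = q} (-r≤p , p≤r) = +-monoʳ-≤ q -r≤p , +-monoʳ-≤ q p≤r

  xyg+xyg≤b[x²+y²] : ∀ x y {g b} → 0ℚ ≤ g → g ≤ b → x * y * g + x * y * g ≤ b * (x * x + y * y)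
  xyg+xyg≤b[x²+y²] x y {g} {b} 0≤g g≤b with ≤-total 0ℚ (x * y)
  ... | inj₁ 0≤xy = ≤-by-gap (b * ((x - y) * (x - y)) + (x * y + x * y) * (b - g))
    (+-mono-≤ (0≤p*q 0≤b (0≤p*p (x - y))) (0≤p*q (+-mono-≤ 0≤xy 0≤xy) (p≤q⇒0≤q-p g≤b)))
    (solve 4 (λ x y g b → x :* y :* g :+ x :* y :* g :+ (b :* ((x :- y) :* (x :- y)) :+ (x :* y :+ x :* y) :* (b :- g))
                        := b :* (x :* x :+ y :* y)) refl x y g b)
    where
    open ℚ-Solver
    0≤b = ≤-trans 0≤g g≤b
  ... | inj₂ xy≤0 = ≤-by-gap (b * (x * x + y * y) + (- (x * y) + - (x * y)) * g)
    (+-mono-≤ (0≤p*q 0≤b (+-mono-≤ (0≤p*p x) (0≤p*p y))) (0≤p*q (+-mono-≤ 0≤-xy 0≤-xy) 0≤g))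
    (solve 4 (λ x y g b → x :* y :* g :+ x :* y :* g :+ (b :* (x :* x :+ y :* y) :+ (:- (x :* y) :+ :- (x :* y)) :* g)
                        := b :* (x :* x :+ y :* y)) refl x y g b)
    where
    open ℚ-Solver
    0≤b = ≤-trans 0≤g g≤b
    0≤-xy = neg-antimono-≤ xy≤0

  ∣xyg+xyg∣≤b[x²+y²] : ∀ x y {g b} → 0ℚ ≤ g → g ≤ b → ∣ x * y * g + x * y * g ∣≤ b * (x * x + y * y)
  ∣xyg+xyg∣≤b[x²+y²] x y {g} {b} 0≤g g≤b =
    subst₂ _≤_ (cong (λ s → - (b * s)) (-x*-x≡x*x)) -[-xyg-xyg]≡xyg+xyg (neg-antimono-≤ (xyg+xyg≤b[x²+y²] (- x) y 0≤g g≤b)) ,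
    xyg+xyg≤b[x²+y²] x y 0≤g g≤b
    where
    open ℚ-Solver
    -x*-x≡x*x : - x * - x + y * y ≡ x * x + y * y
    -x*-x≡x*x = solve 2 (λ x y → :- x :* :- x :+ y :* y := x :* x :+ y :* y) refl x y
    -[-xyg-xyg]≡xyg+xyg : - (- x * y * g + - x * y * g) ≡ x * y * g + x * y * g
    -[-xyg-xyg]≡xyg+xyg = solve 3 (λ x y g → :- (:- x :* y :* g :+ :- x :* y :* g) := x :* y :* g :+ x :* y :* g) refl x y g

  𝟙≢0 : ℚ → ℚ
  𝟙≢0 y = 𝟙 (¬? (y ≟ 0ℚ))

  -- The weights 𝟙≢0 make the bound vanish when x or y is zero, so only pairs
  -- inside the support are charged.
  ∣xyg+xyg∣≤b[x²𝟙y+y²𝟙x] : ∀ x y {g b} → 0ℚ ≤ g → g ≤ b →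
                           ∣ x * y * g + x * y * g ∣≤ b * (x * x * 𝟙≢0 y + y * y * 𝟙≢0 x)
  ∣xyg+xyg∣≤b[x²𝟙y+y²𝟙x] x y {g} {b} 0≤g g≤b with y ≟ 0ℚ
  ... | yes refl = ∣∣≤-cong
    (solve 2 (λ x g → con 0ℚ := x :* con 0ℚ :* g :+ x :* con 0ℚ :* g) refl x g)
    (solve 3 (λ x b v → con 0ℚ := b :* (x :* x :* con 0ℚ :+ con 0ℚ :* con 0ℚ :* v)) refl x b (𝟙≢0 x))
    ∣0∣≤0
    where open ℚ-Solver
  ... | no y≢0 with x ≟ 0ℚ
  ...   | yes refl = ∣∣≤-cong
    (solve 2 (λ y g → con 0ℚ := con 0ℚ :* y :* g :+ con 0ℚ :* y :* g) refl y g)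
    (solve 2 (λ y b → con 0ℚ := b :* (con 0ℚ :* con 0ℚ :* con 1ℚ :+ y :* y :* con 0ℚ)) refl y b)
    ∣0∣≤0
    where open ℚ-Solver
  ...   | no x≢0 = ∣∣≤-cong refl (cong (b *_) (sym (cong₂ _+_ (*-identityʳ (x * x)) (*-identityʳ (y * y)))))
    (∣xyg+xyg∣≤b[x²+y²] x y 0≤g g≤b)

  x²𝟙x≡x² : ∀ x → x * x * 𝟙≢0 x ≡ x * x
  x²𝟙x≡x² x with x ≟ 0ℚ
  ... | yes refl = refl
  ... | no _     = *-identityʳ (x * x)

  module QuadraticForm {A : Set ℓ} (_≟ᴬ_ : DecidableEquality A) (xs : List A) (sift : Sifting _≟ᴬ_ xs) where

    ∑∑ : (A → A → ℚ) → ℚ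
    ∑∑ F = ∑[ c ← xs ] ∑[ d ← xs ] F c d

    quadForm : (A → A → ℚ) → (A → ℚ) → ℚ
    quadForm G x = ∑∑ (λ c d → x c * x d * G c d)

    ‖_‖² : (A → ℚ) → ℚ
    ‖ x ‖² = ∑[ c ← xs ] x c * x c

    supportSize : (A → ℚ) → ℕ
    supportSize x = length (filter (λ c → ¬? (x c ≟ 0ℚ)) xs)

    𝟙≢ : A → A → ℚ
    𝟙≢ c d = 𝟙 (¬? (c ≟ᴬ d))

    offDiagonal : (A → A → ℚ) → A → A → ℚ
    offDiagonal G c d = 𝟙≢ c d * G c d

    ∑∑-cong : ∀ {F F′ : A → A → ℚ} → (∀ c d → F c d ≡ F′ c d) → ∑∑ F ≡ ∑∑ F′
    ∑∑-cong F≡F′ = ∑-cong xs (λ c → ∑-cong xs (F≡F′ c))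

    ∑∑-distrib-+ : ∀ (F F′ : A → A → ℚ) → ∑∑ (λ c d → F c d + F′ c d) ≡ ∑∑ F + ∑∑ F′
    ∑∑-distrib-+ F F′ = trans (∑-cong xs (λ c → ∑-distrib-+ xs (F c) (F′ c)))
                              (∑-distrib-+ xs (λ c → ∑ xs (F c)) (λ c → ∑ xs (F′ c)))

    *-distribˡ-∑∑ : ∀ r (F : A → A → ℚ) → r * ∑∑ F ≡ ∑∑ (λ c d → r * F c d)
    *-distribˡ-∑∑ r F = trans (*-distribˡ-∑ xs r (λ c → ∑ xs (F c))) (∑-cong xs (λ c → *-distribˡ-∑ xs r (F c)))

    ∑∑-transpose : ∀ (F : A → A → ℚ) → ∑∑ (λ c d → F d c) ≡ ∑∑ F
    ∑∑-transpose F = ∑-comm xs xs (λ c d → F d c)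

    ∑∑-∣∣≤ : ∀ {F R : A → A → ℚ} → (∀ c d → ∣ F c d ∣≤ R c d) → ∣ ∑∑ F ∣≤ ∑∑ R
    ∑∑-∣∣≤ F≤R = ∑-∣∣≤ xs (λ c → ∑-∣∣≤ xs (F≤R c))

    𝟙≢-sym : ∀ c d → 𝟙≢ c d ≡ 𝟙≢ d c
    𝟙≢-sym c d = 𝟙-⇔ (¬? (c ≟ᴬ d)) (¬? (d ≟ᴬ c)) (λ c≢d d≡c → c≢d (sym d≡c)) (λ d≢c c≡d → d≢c (sym c≡d))

    ∑-𝟙≢ : ∀ c f → ∑[ d ← xs ] 𝟙≢ c d * f d + f c ≡ ∑ xs f
    ∑-𝟙≢ c f = begin
      ∑[ d ← xs ] 𝟙≢ c d * f d + f c
        ≡⟨ cong (_+_ (∑[ d ← xs ] 𝟙≢ c d * f d)) (sift c f) ⟨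
      ∑[ d ← xs ] 𝟙≢ c d * f d + ∑[ d ← xs ] 𝟙 (c ≟ᴬ d) * f d
        ≡⟨ ∑-distrib-+ xs (λ d → 𝟙≢ c d * f d) (λ d → 𝟙 (c ≟ᴬ d) * f d) ⟨
      ∑[ d ← xs ] (𝟙≢ c d * f d + 𝟙 (c ≟ᴬ d) * f d)
        ≡⟨ ∑-cong xs partition ⟩
      ∑ xs f
        ∎
      where
      open ≡-Reasoning
      partition : ∀ d → 𝟙≢ c d * f d + 𝟙 (c ≟ᴬ d) * f d ≡ f d
      partition d = begin
        𝟙≢ c d * f d + 𝟙 (c ≟ᴬ d) * f d    ≡⟨ *-distribʳ-+ (f d) (𝟙≢ c d) (𝟙 (c ≟ᴬ d)) ⟨
        (𝟙≢ c d + 𝟙 (c ≟ᴬ d)) * f d        ≡⟨ cong (_* f d) (+-comm (𝟙≢ c d) (𝟙 (c ≟ᴬ d))) ⟩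
        (𝟙 (c ≟ᴬ d) + 𝟙≢ c d) * f d        ≡⟨ cong (_* f d) (𝟙+𝟙-¬≡1 (c ≟ᴬ d)) ⟩
        1ℚ * f d                           ≡⟨ *-identityˡ (f d) ⟩
        f d                                ∎

    quadForm-split : ∀ G x → quadForm G x ≡ quadForm (offDiagonal G) x + ∑[ c ← xs ] x c * x c * G c c
    quadForm-split G x = begin
      ∑[ c ← xs ] ∑[ d ← xs ] x c * x d * G c d
        ≡⟨ ∑-cong xs row-split ⟩
      ∑[ c ← xs ] (∑[ d ← xs ] x c * x d * offDiagonal G c d + x c * x c * G c c)
        ≡⟨ ∑-distrib-+ xs (λ c → ∑[ d ← xs ] x c * x d * offDiagonal G c d) (λ c → x c * x c * G c c) ⟩
      quadForm (offDiagonal G) x + ∑[ c ← xs ] x c * x c * G c c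
        ∎
      where
      open ≡-Reasoning
      row-split : ∀ c → ∑[ d ← xs ] x c * x d * G c d ≡ ∑[ d ← xs ] x c * x d * offDiagonal G c d + x c * x c * G c c
      row-split c = trans (sym (∑-𝟙≢ c (λ d → x c * x d * G c d)))
        (cong (_+ x c * x c * G c c) (∑-cong xs (λ d →
          solve 4 (λ e u v g → e :* (u :* v :* g) := u :* v :* (e :* g)) refl (𝟙≢ c d) (x c) (x d) (G c d))))
        where open ℚ-Solver

    -- Summed over all pairs, x_c² is counted once for every other support
    -- point d, i.e. (|supp x| − 1) times: the source of s − 1 in δ.
    pairWeight : (A → ℚ) → A → A → ℚ
    pairWeight x c d = 𝟙≢ c d * (x c * x c * 𝟙≢0 (x d))

    ∑∑-pairWeight : ∀ x → ∑∑ (pairWeight x) + ‖ x ‖² ≡ fromℕ (supportSize x) * ‖ x ‖²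
    ∑∑-pairWeight x = begin
      ∑∑ (pairWeight x) + ‖ x ‖²
        ≡⟨ cong (_+_ (∑∑ (pairWeight x))) (∑-cong xs (λ c → x²𝟙x≡x² (x c))) ⟨
      ∑∑ (pairWeight x) + ∑[ c ← xs ] x c * x c * ν c
        ≡⟨ ∑-distrib-+ xs (λ c → ∑[ d ← xs ] 𝟙≢ c d * (x c * x c * ν d)) (λ c → x c * x c * ν c) ⟨
      ∑[ c ← xs ] (∑[ d ← xs ] 𝟙≢ c d * (x c * x c * ν d) + x c * x c * ν c)
        ≡⟨ ∑-cong xs row ⟩
      ∑[ c ← xs ] x c * x c * fromℕ (supportSize x)
        ≡⟨ *-distribʳ-∑ xs (fromℕ (supportSize x)) (λ c → x c * x c) ⟨
      ‖ x ‖² * fromℕ (supportSize x)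
        ≡⟨ *-comm ‖ x ‖² (fromℕ (supportSize x)) ⟩
      fromℕ (supportSize x) * ‖ x ‖²
        ∎
      where
      open ≡-Reasoning
      ν : A → ℚ
      ν d = 𝟙≢0 (x d)
      row : ∀ c → ∑[ d ← xs ] 𝟙≢ c d * (x c * x c * ν d) + x c * x c * ν c ≡ x c * x c * fromℕ (supportSize x)
      row c = begin
        ∑[ d ← xs ] 𝟙≢ c d * (x c * x c * ν d) + x c * x c * ν c
          ≡⟨ cong (_+ x c * x c * ν c) (∑-cong xs (λ d →
               solve 3 (λ e X v → e :* (X :* v) := X :* (e :* v)) refl (𝟙≢ c d) (x c * x c) (ν d))) ⟩
        ∑[ d ← xs ] x c * x c * (𝟙≢ c d * ν d) + x c * x c * ν c
          ≡⟨ cong (_+ x c * x c * ν c) (*-distribˡ-∑ xs (x c * x c) (λ d → 𝟙≢ c d * ν d)) ⟨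
        x c * x c * (∑[ d ← xs ] 𝟙≢ c d * ν d) + x c * x c * ν c
          ≡⟨ *-distribˡ-+ (x c * x c) (∑[ d ← xs ] 𝟙≢ c d * ν d) (ν c) ⟨
        x c * x c * (∑[ d ← xs ] 𝟙≢ c d * ν d + ν c)
          ≡⟨ cong (x c * x c *_) (trans (∑-𝟙≢ c ν) (∑-count (λ d → ¬? (x d ≟ 0ℚ)) xs)) ⟩
        x c * x c * fromℕ (supportSize x)
          ∎
        where open ℚ-Solver

    ‖x‖²-nonNeg : ∀ x → 0ℚ ≤ ‖ x ‖²
    ‖x‖²-nonNeg x = ∑-nonNeg xs (λ c → 0≤p*p (x c))

    ∑∑-pairWeight≤ : ∀ x m → supportSize x ℕ.≤ suc m → ∑∑ (pairWeight x) ≤ fromℕ m * ‖ x ‖²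
    ∑∑-pairWeight≤ x m supp = +-cancelʳ-≤ N (begin
      ∑∑ (pairWeight x) + N     ≡⟨ ∑∑-pairWeight x ⟩
      fromℕ (supportSize x) * N ≤⟨ *-monoʳ-≤-nonNeg N {{nonNegative (‖x‖²-nonNeg x)}} (fromℕ-mono-≤ supp) ⟩
      fromℕ (suc m) * N         ≡⟨ cong (_* N) (fromℕ-suc m) ⟩
      (1ℚ + fromℕ m) * N        ≡⟨ solve 2 (λ m N → (con 1ℚ :+ m) :* N := m :* N :+ N) refl (fromℕ m) N ⟩
      fromℕ m * N + N           ∎)
      where
      open ≤-Reasoning
      open ℚ-Solver
      N = ‖ x ‖²

    module _ (G : A → A → ℚ) {τ : ℚ} (0≤τ : 0ℚ ≤ τ) (G-off : ∀ {c d} → ¬ c ≡ d → 0ℚ ≤ G c d × G c d ≤ τ) where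

      offDiagonal-bounded : ∀ c d → 0ℚ ≤ offDiagonal G c d × offDiagonal G c d ≤ 𝟙≢ c d * τ
      offDiagonal-bounded c d with c ≟ᴬ d
      ... | yes _   = ≤-reflexive (sym (*-zeroˡ (G c d))) , ≤-reflexive (trans (*-zeroˡ (G c d)) (sym (*-zeroˡ τ)))
      ... | no c≢d  = subst₂ (λ g b → 0ℚ ≤ g × g ≤ b) (sym (*-identityˡ (G c d))) (sym (*-identityˡ τ)) (G-off c≢d)

      ∣quadForm-offDiagonal∣≤ : ∀ x m → supportSize x ℕ.≤ suc m →
                                ∣ quadForm (offDiagonal G) x ∣≤ τ * fromℕ m * ‖ x ‖²
      ∣quadForm-offDiagonal∣≤ x m supp = ∣∣≤-cong refl (sym (*-assoc τ (fromℕ m) ‖ x ‖²))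
        (∣∣≤-half (∣∣≤-mono τ[P+P]≤ (∣∣≤-cong (∑∑-distrib-+ T T) ∑∑R≡τ[P+P] (∑∑-∣∣≤ entry))))
        where
        open ℚ-Solver
        N = ‖ x ‖²
        T : A → A → ℚ
        T c d = x c * x d * offDiagonal G c d
        P = pairWeight x
        R : A → A → ℚ
        R c d = 𝟙≢ c d * τ * (x c * x c * 𝟙≢0 (x d) + x d * x d * 𝟙≢0 (x c))

        entry : ∀ c d → ∣ T c d + T c d ∣≤ R c d
        entry c d = ∣xyg+xyg∣≤b[x²𝟙y+y²𝟙x] (x c) (x d) (proj₁ (offDiagonal-bounded c d)) (proj₂ (offDiagonal-bounded c d))

        ∑∑R≡τ[P+P] : ∑∑ R ≡ τ * (∑∑ P + ∑∑ P)
        ∑∑R≡τ[P+P] = begin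
          ∑∑ R                                       ≡⟨ ∑∑-cong R≡τ[P+Pᵀ] ⟩
          ∑∑ (λ c d → τ * (P c d + P d c))           ≡⟨ *-distribˡ-∑∑ τ (λ c d → P c d + P d c) ⟨
          τ * ∑∑ (λ c d → P c d + P d c)             ≡⟨ cong (τ *_) (∑∑-distrib-+ P (λ c d → P d c)) ⟩
          τ * (∑∑ P + ∑∑ (λ c d → P d c))            ≡⟨ cong (λ s → τ * (∑∑ P + s)) (∑∑-transpose P) ⟩
          τ * (∑∑ P + ∑∑ P)                          ∎
          where
          open ≡-Reasoning
          R≡τ[P+Pᵀ] : ∀ c d → R c d ≡ τ * (P c d + P d c)
          R≡τ[P+Pᵀ] c d = trans
            (solve 4 (λ e t u v → e :* t :* (u :+ v) := t :* (e :* u :+ e :* v)) refl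
                     (𝟙≢ c d) τ (x c * x c * 𝟙≢0 (x d)) (x d * x d * 𝟙≢0 (x c)))
            (cong (λ e → τ * (P c d + e * (x d * x d * 𝟙≢0 (x c)))) (𝟙≢-sym c d))

        τ[P+P]≤ : τ * (∑∑ P + ∑∑ P) ≤ τ * (fromℕ m * N) + τ * (fromℕ m * N)
        τ[P+P]≤ = subst (τ * (∑∑ P + ∑∑ P) ≤_) (*-distribˡ-+ τ (fromℕ m * N) (fromℕ m * N))
                    (*-monoˡ-≤-nonNeg τ {{nonNegative 0≤τ}} (+-mono-≤ (∑∑-pairWeight≤ x m supp) (∑∑-pairWeight≤ x m supp)))

      quadForm-bounds : ∀ {κ} → (∀ c → G c c ≡ κ) → ∀ x m → supportSize x ℕ.≤ suc m →
                        κ * ‖ x ‖² - τ * fromℕ m * ‖ x ‖² ≤ quadForm G x ×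
                        quadForm G x ≤ κ * ‖ x ‖² + τ * fromℕ m * ‖ x ‖²
      quadForm-bounds {κ} G-diag x m supp =
        subst (λ Q → _ ≤ Q × Q ≤ _) (sym Q≡κN+Qₒ) (∣∣≤⇒around {q = κ * ‖ x ‖²} (∣quadForm-offDiagonal∣≤ x m supp))
        where
        open ≡-Reasoning
        Q≡κN+Qₒ : quadForm G x ≡ κ * ‖ x ‖² + quadForm (offDiagonal G) x
        Q≡κN+Qₒ = begin
          quadForm G x                                                ≡⟨ quadForm-split G x ⟩
          quadForm (offDiagonal G) x + ∑[ c ← xs ] x c * x c * G c c  ≡⟨ cong (_+_ (quadForm (offDiagonal G) x)) diagonal ⟩
          quadForm (offDiagonal G) x + κ * ‖ x ‖²                     ≡⟨ +-comm (quadForm (offDiagonal G) x) (κ * ‖ x ‖²) ⟩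
          κ * ‖ x ‖² + quadForm (offDiagonal G) x                     ∎
          where
          diagonal : ∑[ c ← xs ] x c * x c * G c c ≡ κ * ‖ x ‖²
          diagonal = trans (∑-cong xs (λ c → cong (x c * x c *_) (G-diag c)))
                           (trans (sym (*-distribʳ-∑ xs κ (λ c → x c * x c))) (*-comm ‖ x ‖² κ))

    gram : {R : Set ℓ} → List R → (R → A → ℚ) → A → A → ℚ
    gram rs M c d = ∑[ r ← rs ] M r c * M r d

    ‖Mx‖²≡quadForm-gram : ∀ {R : Set ℓ} (rs : List R) (M : R → A → ℚ) x →
      ∑[ r ← rs ] (∑[ c ← xs ] M r c * x c) * (∑[ d ← xs ] M r d * x d) ≡ quadForm (gram rs M) x
    ‖Mx‖²≡quadForm-gram rs M x = begin
      ∑[ r ← rs ] (∑[ c ← xs ] M r c * x c) * (∑[ d ← xs ] M r d * x d)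
        ≡⟨ ∑-cong rs (λ r → ∑*∑≡∑∑ xs xs (λ c → M r c * x c) (λ d → M r d * x d)) ⟩
      ∑[ r ← rs ] ∑[ c ← xs ] ∑[ d ← xs ] M r c * x c * (M r d * x d)
        ≡⟨ ∑-comm rs xs (λ r c → ∑[ d ← xs ] M r c * x c * (M r d * x d)) ⟩
      ∑[ c ← xs ] ∑[ r ← rs ] ∑[ d ← xs ] M r c * x c * (M r d * x d)
        ≡⟨ ∑-cong xs (λ c → ∑-comm rs xs (λ r d → M r c * x c * (M r d * x d))) ⟩
      ∑[ c ← xs ] ∑[ d ← xs ] ∑[ r ← rs ] M r c * x c * (M r d * x d)
        ≡⟨ ∑∑-cong (λ c d → ∑-cong rs (λ r → regroup (M r c) (x c) (M r d) (x d))) ⟩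
      ∑[ c ← xs ] ∑[ d ← xs ] ∑[ r ← rs ] x c * x d * (M r c * M r d)
        ≡⟨ ∑∑-cong (λ c d → *-distribˡ-∑ rs (x c * x d) (λ r → M r c * M r d)) ⟨
      quadForm (gram rs M) x
        ∎
      where
      open ≡-Reasoning
      regroup : ∀ p u q v → p * u * (q * v) ≡ u * v * (p * q)
      regroup = solve 4 (λ p u q v → p :* u :* (q :* v) := u :* v :* (p :* q)) refl
        where open ℚ-Solver

  agreements-self : ∀ {n k} (u : Vec (Fin n) k) → agreements u u ≡ k
  agreements-self {k = k} u = trans
    (cong length (List.filter-all (λ r → lookup u r Fin.≟ lookup u r) (All.tabulate⁺ {f = id} (λ _ → refl))))
    (List.length-tabulate {n = k} id)

  hamming-pos : ∀ {n m} {u v : Vec (Fin n) m} → ¬ u ≡ v → 0 ℕ.< hamming u v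
  hamming-pos {m = m} {u} {v} u≢v = List.filter-some (λ p → ¬? (lookup u p Fin.≟ lookup v p)) (Any.tabulate⁺ i uᵢ≢vᵢ)
    where
    i,uᵢ≢vᵢ = Fin.¬∀⟶∃¬ m _ (λ p → lookup u p Fin.≟ lookup v p) (λ u≗v → u≢v (Pointwise-≡⇒≡ (ext u≗v)))
    i = proj₁ i,uᵢ≢vᵢ
    uᵢ≢vᵢ = proj₂ i,uᵢ≢vᵢ

  IsGES⇒agreements≤ : ∀ {n k t a} → IsGES n k t a → ∀ {c d} → ¬ c ≡ d → agreements (a c) (a d) ℕ.≤ t
  IsGES⇒agreements≤ {t = t} {a = a} ges {c} {d} c≢d with hamming c d in eq | hamming-pos c≢d
  ... | zero        | ()
  ... | suc zero    | _ = subst (ℕ._≤ t) (sym no-agreements) z≤n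
    where
    no-agreements : agreements (a c) (a d) ≡ 0
    no-agreements = cong length (List.filter-none (λ r → lookup (a c) r Fin.≟ lookup (a d) r)
                                                  (All.tabulate⁺ (IsGES.cond1 ges c d eq)))
  ... | suc (suc _) | _ = IsGES.cond2 ges c d (subst (2 ℕ.≤_) (sym eq) (s≤s (s≤s z≤n)))

  module _ {n k t : ℕ} (a : Vec (Fin n) (suc t) → Vec (Fin n) k) where

    open QuadraticForm _≟ⱽ_ (allVecs n (suc t)) (allVecs-sifting n (suc t))

    Φ-combine : ∀ l s c → Φ a (combine l s) c ≡ 𝟙 (lookup (a c) l Fin.≟ s)
    Φ-combine l s c = 𝟙-⇔ (Fin.any? (λ l′ → combine l s Fin.≟ combine l′ (lookup (a c) l′))) (lookup (a c) l Fin.≟ s)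
      (λ (l′ , eq) → let l≡l′ , s≡aₗ′ = Fin.combine-injective l s l′ (lookup (a c) l′) eq
                     in trans (cong (lookup (a c)) l≡l′) (sym s≡aₗ′))
      (λ aₗ≡s → l , cong (combine l) (sym aₗ≡s))

    gram-Φ≡agreements : ∀ c d → gram (allFin (k ℕ.* n)) (Φ a) c d ≡ fromℕ (agreements (a c) (a d))
    gram-Φ≡agreements c d = begin
      ∑[ r ← allFin (k ℕ.* n) ] Φ a r c * Φ a r d
        ≡⟨ ∑-allFin-combine k n (λ r → Φ a r c * Φ a r d) ⟩
      ∑[ l ← allFin k ] ∑[ s ← allFin n ] Φ a (combine l s) c * Φ a (combine l s) d
        ≡⟨ ∑-cong (allFin k) (λ l → ∑-cong (allFin n) (λ s → cong₂ _*_ (Φ-combine l s c) (Φ-combine l s d))) ⟩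
      ∑[ l ← allFin k ] ∑[ s ← allFin n ] 𝟙 (u l Fin.≟ s) * 𝟙 (v l Fin.≟ s)
        ≡⟨ ∑-cong (allFin k) (λ l → allFin-sifting n (u l) (λ s → 𝟙 (v l Fin.≟ s))) ⟩
      ∑[ l ← allFin k ] 𝟙 (v l Fin.≟ u l)
        ≡⟨ ∑-cong (allFin k) (λ l → 𝟙-⇔ (v l Fin.≟ u l) (u l Fin.≟ v l) sym sym) ⟩
      ∑[ l ← allFin k ] 𝟙 (u l Fin.≟ v l)
        ≡⟨ ∑-count (λ l → u l Fin.≟ v l) (allFin k) ⟩
      fromℕ (agreements (a c) (a d))
        ∎
      where
      open ≡-Reasoning
      u v : Fin k → Fin n
      u = lookup (a c)
      v = lookup (a d)

    ‖Φx‖²-bounds : IsGES n k t a → ∀ x j → support x ℕ.≤ suc j →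
      fromℕ k * sqNorm x - fromℕ t * fromℕ j * sqNorm x ≤ sqNormRows (mulVec (Φ a) x) ×
      sqNormRows (mulVec (Φ a) x) ≤ fromℕ k * sqNorm x + fromℕ t * fromℕ j * sqNorm x
    ‖Φx‖²-bounds ges x j supp =
      subst (λ Q → _ ≤ Q × Q ≤ _) (sym (‖Mx‖²≡quadForm-gram (allFin (k ℕ.* n)) (Φ a) x))
            (quadForm-bounds G (fromℕ-nonNeg t) G-off G-diag x j supp)
      where
      G = gram (allFin (k ℕ.* n)) (Φ a)
      G-diag : ∀ c → G c c ≡ fromℕ k
      G-diag c = trans (gram-Φ≡agreements c c) (cong fromℕ (agreements-self (a c)))
      G-off : ∀ {c d} → ¬ c ≡ d → 0ℚ ≤ G c d × G c d ≤ fromℕ t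
      G-off {c} {d} c≢d = subst (λ g → 0ℚ ≤ g × g ≤ fromℕ t) (sym (gram-Φ≡agreements c d))
                                (fromℕ-nonNeg (agreements (a c) (a d)) , fromℕ-mono-≤ (IsGES⇒agreements≤ ges c≢d))

  rescale : ∀ {e κ ρ δ Q N} → 0ℚ ≤ e → e * κ ≡ 1ℚ → e * ρ ≡ δ →
            κ * N - ρ * N ≤ Q × Q ≤ κ * N + ρ * N →
            (1ℚ - δ) * N ≤ e * Q × e * Q ≤ (1ℚ + δ) * N
  rescale {e} {κ} {ρ} {δ} {Q} {N} 0≤e eκ≡1 eρ≡δ (lower , upper) =
    subst (_≤ e * Q) e[κN-ρN]≡[1-δ]N (*-monoˡ-≤-nonNeg e {{nonNegative 0≤e}} lower) ,
    subst (e * Q ≤_) e[κN+ρN]≡[1+δ]N (*-monoˡ-≤-nonNeg e {{nonNegative 0≤e}} upper)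
    where
    open ℚ-Solver
    open ≡-Reasoning
    e[κN-ρN]≡[1-δ]N : e * (κ * N - ρ * N) ≡ (1ℚ - δ) * N
    e[κN-ρN]≡[1-δ]N = begin
      e * (κ * N - ρ * N)     ≡⟨ solve 4 (λ e κ ρ N → e :* (κ :* N :- ρ :* N) := e :* κ :* N :- e :* ρ :* N) refl e κ ρ N ⟩
      e * κ * N - e * ρ * N   ≡⟨ cong₂ (λ u v → u * N - v * N) eκ≡1 eρ≡δ ⟩
      1ℚ * N - δ * N          ≡⟨ solve 2 (λ δ N → con 1ℚ :* N :- δ :* N := (con 1ℚ :- δ) :* N) refl δ N ⟩
      (1ℚ - δ) * N            ∎
    e[κN+ρN]≡[1+δ]N : e * (κ * N + ρ * N) ≡ (1ℚ + δ) * N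
    e[κN+ρN]≡[1+δ]N = begin
      e * (κ * N + ρ * N)     ≡⟨ solve 4 (λ e κ ρ N → e :* (κ :* N :+ ρ :* N) := e :* κ :* N :+ e :* ρ :* N) refl e κ ρ N ⟩
      e * κ * N + e * ρ * N   ≡⟨ cong₂ (λ u v → u * N + v * N) eκ≡1 eρ≡δ ⟩
      1ℚ * N + δ * N          ≡⟨ solve 2 (λ δ N → con 1ℚ :* N :+ δ :* N := (con 1ℚ :+ δ) :* N) refl δ N ⟩
      (1ℚ + δ) * N            ∎

  rescale-by-1/k : ∀ k t j {Q N} →
    fromℕ (suc k) * N - fromℕ t * fromℕ j * N ≤ Q × Q ≤ fromℕ (suc k) * N + fromℕ t * fromℕ j * N →
    (1ℚ - + (t ℕ.* j) / suc k) * N ≤ (+ 1 / suc k) * Q × (+ 1 / suc k) * Q ≤ (1ℚ + + (t ℕ.* j) / suc k) * N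
  rescale-by-1/k k t j = rescale (nonNegative⁻¹ (+ 1 / suc k) {{normalize-nonNeg 1 (suc k)}}) (1/n*n≡1 k)
    (trans (cong (+ 1 / suc k *_) (sym (fromℕ-* t j))) (sym (m/n≡1/n*m (t ℕ.* j) k)))

open import Data.Nat using (ℕ; suc; _≤_; _<_; _*_; _∸_; NonZero)
open import Data.Nat using (zero)
open import Data.Fin using (Fin)
open import Data.Vec using (Vec)
open import Data.Integer using (+_)
open import Data.Rational using (_/_)
open RestrictedIsometry using (‖Φx‖²-bounds; rescale-by-1/k)

mainTheorem4 : (n k t : ℕ) → .{{_ : NonZero k}} → 1 ≤ t → t < k → k < n →
    (a : Vec (Fin n) (suc t) → Vec (Fin n) k) → IsGES n k t a →
    (k′ : ℕ) → 1 ≤ k′ → t * (k′ ∸ 1) < k →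
    RIP (Φ₀sqNorm a) k′ ((+ (t * (k′ ∸ 1))) / k)
mainTheorem4 _ zero    _ _ () _ _ _ _ _ _
mainTheorem4 _ (suc k) _ _ _ _ _ _ zero () _
mainTheorem4 n (suc k) t _ _ _ a ges (suc j) _ _ x supp = rescale-by-1/k k t j (‖Φx‖²-bounds a ges x j supp)
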